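{- Let $\varphi(\mathbf{x},\mathbf{y})$ be a P-encoding with $n\ge4$ input variables $\mathbf{x}=(x_1,\dots,x_n)$ and let $i,j,k\in\{1,\dots,n\}$ be three different indices. Then $Q_{\varphi,i}\ne\{\neg x_i\vee\neg x_j,\ \neg x_i\vee\neg x_k\}$.
   Context: A CNF formula is a conjunction (set) of clauses (disjunctions of literals with no complementary pair). Unit resolution: from a unit clause $l$ and a clause containing $\neg l$ derive the clause with $\neg l$ removed; $\varphi\wedge g\vdash_1 h$ means the literal $h$ is derivable from $\varphi$ and the unit clause $g$ by a sequence of unit resolutions. $\varphi(\mathbf{x},\mathbf{y})$ is a P-encoding if (P1) $\varphi\wedge x_i$ is satisfiable for each $i$ and (P2) $\varphi\wedge x_i\vdash_1\neg x_j$ for all $i\ne j$. $Q_{\varphi,i}=\{C\in\varphi:\neg x_i\in C\}$. -}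

module Defs where

open import Data.Nat using (ℕ)
open import Data.Fin using (Fin)
open import Data.Bool using (Bool; true; false)
open import Data.Sum using (_⊎_; inj₁; inj₂)
open import Data.Product using (Σ; ∃; _×_; _,_)
open import Data.List using (List; []; _∷_)
open import Data.List.Membership.Propositional using (_∈_)
open import Relation.Binary.PropositionalEquality using (_≡_)
open import Relation.Nullary using (¬_)
open import Data.Empty using (⊥)

-- Variables of φ(x,y): n input variables x and m auxiliary variables y.
Var : ℕ → ℕ → Set
Var n m = Fin n ⊎ Fin m

-- How a variable occurs in a clause.  A clause is a function assigning to
-- every variable one occurrence status; this represents a set of literals
-- with no complementary pair.
data Occ : Set where
  absent pos neg : Occ

Clause : ℕ → ℕ → Set
Clause n m = Var n m → Occ

CNF : ℕ → ℕ → Set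
CNF n m = List (Clause n m)

-- Literals: a variable together with a polarity (true = positive).
record Lit (n m : ℕ) : Set where
  constructor lit
  field
    var  : Var n m
    sign : Bool
open Lit public

occOf : Bool → Occ
occOf true  = pos
occOf false = neg

occOfNeg : Bool → Occ
occOfNeg true  = neg
occOfNeg false = pos

xl : ∀ {n m} → Fin n → Lit n m
xl i = lit (inj₁ i) true

¬xl : ∀ {n m} → Fin n → Lit n m
¬xl i = lit (inj₁ i) false

_∈ᶜ_ : ∀ {n m} → Lit n m → Clause n m → Set
l ∈ᶜ C = C (var l) ≡ occOf (sign l)

_≈ᶜ_ : ∀ {n m} → Clause n m → Clause n m → Set
C ≈ᶜ D = ∀ v → C v ≡ D v

open import Data.Fin.Properties using () renaming (_≟_ to _≟ᶠ_)
open import Data.Sum.Properties using (≡-dec)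
open import Relation.Nullary using (yes; no)

_≟ᵛ_ : ∀ {n m} → (u v : Var n m) → Relation.Nullary.Dec (u ≡ v)
_≟ᵛ_ = ≡-dec _≟ᶠ_ _≟ᶠ_

unit : ∀ {n m} → Lit n m → Clause n m
unit l v with v ≟ᵛ var l
... | yes _ = occOf (sign l)
... | no  _ = absent

remove : ∀ {n m} → Var n m → Clause n m → Clause n m
remove u C v with v ≟ᵛ u
... | yes _ = absent
... | no  _ = C v

compl : ∀ {n m} → Lit n m → Lit n m
compl (lit v true)  = lit v false
compl (lit v false) = lit v true

-- Clauses derivable from φ ∧ g by unit resolution.
data Derivable {n m} (φ : CNF n m) (g : Lit n m) : Clause n m → Set where
  base   : ∀ {C} → C ∈ φ → Derivable φ g C
  given  : Derivable φ g (unit g)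
  resolve : ∀ {U C} (l : Lit n m) → Derivable φ g U → U ≈ᶜ unit l →
            Derivable φ g C → compl l ∈ᶜ C → Derivable φ g (remove (var l) C)

_∧_⊢₁_ : ∀ {n m} → CNF n m → Lit n m → Lit n m → Set
φ ∧ g ⊢₁ h = ∃ λ C → Derivable φ g C × C ≈ᶜ unit h

Assignment : ℕ → ℕ → Set
Assignment n m = Var n m → Bool

SatLit : ∀ {n m} → Assignment n m → Lit n m → Set
SatLit α l = α (var l) ≡ sign l

SatClause : ∀ {n m} → Assignment n m → Clause n m → Set
SatClause α C = ∃ λ (l : Lit _ _) → l ∈ᶜ C × SatLit α l

SatCNF : ∀ {n m} → Assignment n m → CNF n m → Set
SatCNF α φ = ∀ {C} → C ∈ φ → SatClause α C

SatWith : ∀ {n m} → CNF n m → Lit n m → Set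
SatWith φ l = ∃ λ α → SatCNF α φ × SatLit α l

IsPEncoding : ∀ {n m} → CNF n m → Set
IsPEncoding {n} φ =
  (∀ (i : Fin n) → SatWith φ (xl i)) ×
  (∀ (i j : Fin n) → ¬ (i ≡ j) → φ ∧ xl i ⊢₁ ¬xl j)

InQ : ∀ {n m} → CNF n m → Fin n → Clause n m → Set
InQ φ i C = C ∈ φ × (¬xl i ∈ᶜ C)

negPair : ∀ {n m} → Fin n → Fin n → Clause n m
negPair a b v with v ≟ᵛ inj₁ a
... | yes _ = neg
... | no _ with v ≟ᵛ inj₁ b
...   | yes _ = neg
...   | no  _ = absent

SameClauseSet : ∀ {n m} → (Clause n m → Set) → List (Clause n m) → Set
SameClauseSet P S =
  (∀ C → P C → ∃ λ D → D ∈ S × C ≈ᶜ D) ×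
  (∀ D → D ∈ S → ∃ λ C → P C × C ≈ᶜ D)

module Submission where

-- Unit resolution is sound: an assignment satisfying φ and the
-- literal g satisfies every clause derivable from φ ∧ g, hence every literal
-- h with φ ∧ g ⊢₁ h.  Suppose Q_{φ,i} = {¬x_i ∨ ¬x_j, ¬x_i ∨ ¬x_k}.  Since
-- n ≥ 4 there is an index l ∉ {i, j, k}.  By (P1) some α satisfies φ ∧ x_l,
-- and by (P2) and soundness α makes every other input variable false, in
-- particular x_i, x_j and x_k.  Flip x_i to true: the only clauses that could
-- lose their satisfying literal are those containing ¬x_i, i.e. the two
-- clauses of Q_{φ,i}, and they stay satisfied by ¬x_j resp. ¬x_k.  So the
-- flipped assignment satisfies φ ∧ x_l ∧ x_i, whereas (P2) and soundness
-- force ¬x_i from φ ∧ x_l — a contradiction.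

open import Defs
open import Data.Nat using (ℕ; _≥_; s≤s)
open import Data.Fin using (Fin; zero; punchIn; punchOut)
open import Data.Fin.Properties
  using (punchInᵢ≢i; punchIn-injective; punchIn-punchOut; punchOut-injective)
open import Data.List using (_∷_; [])
open import Data.List.Membership.Propositional using (_∈_)
open import Data.List.Relation.Unary.Any using (here; there)
open import Data.Bool using (true; false; not)
open import Data.Bool.Properties using (not-¬)
open import Data.Sum using (inj₁)
open import Data.Sum.Properties using (inj₁-injective)
open import Data.Product using (_,_; _×_; ∃)
open import Data.Empty using (⊥-elim)
open import Relation.Binary.PropositionalEquality
  using (_≡_; _≢_; refl; sym; trans; cong)
open import Relation.Nullary using (¬_; yes; no)

occOf-injective : ∀ {a b} → occOf a ≡ occOf b → a ≡ b
occOf-injective {true}  {true}  _ = refl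
occOf-injective {false} {false} _ = refl
occOf-injective {true}  {false} ()
occOf-injective {false} {true}  ()

absent≢occOf : ∀ b → absent ≢ occOf b
absent≢occOf true  ()
absent≢occOf false ()

∈-unit : ∀ {n m} (l l′ : Lit n m) → l′ ∈ᶜ unit l → var l′ ≡ var l × sign l′ ≡ sign l
∈-unit l l′ l′∈ with var l′ ≟ᵛ var l
... | yes v≡ = v≡ , sym (occOf-injective l′∈)
... | no  _  = ⊥-elim (absent≢occOf (sign l′) l′∈)

unit-self : ∀ {n m} (l : Lit n m) → l ∈ᶜ unit l
unit-self l with var l ≟ᵛ var l
... | yes _   = refl
... | no  v≢v = ⊥-elim (v≢v refl)

remove-other : ∀ {n m} {u v : Var n m} (C : Clause n m) → v ≢ u → remove u C v ≡ C v
remove-other {u = u} {v} C v≢u with v ≟ᵛ u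
... | yes v≡u = ⊥-elim (v≢u v≡u)
... | no  _   = refl

var-compl : ∀ {n m} (l : Lit n m) → var (compl l) ≡ var l
var-compl (lit v true)  = refl
var-compl (lit v false) = refl

sign-compl : ∀ {n m} (l : Lit n m) → sign (compl l) ≡ not (sign l)
sign-compl (lit v true)  = refl
sign-compl (lit v false) = refl

sat-unit : ∀ {n m} {α : Assignment n m} {U : Clause n m} (l : Lit n m) →
           U ≈ᶜ unit l → SatClause α U → SatLit α l
sat-unit {α = α} l U≈ (l′ , l′∈U , αl′) with ∈-unit l l′ (trans (sym (U≈ (var l′))) l′∈U)
... | v≡ , s≡ = trans (cong α (sym v≡)) (trans αl′ s≡)

module Soundness {n m} (φ : CNF n m) (α : Assignment n m) (α⊨φ : SatCNF α φ) where

  sound : ∀ {g C} → SatLit α g → Derivable φ g C → SatClause α C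
  sound αg (base C∈φ) = α⊨φ C∈φ
  sound {g} αg given  = g , unit-self g , αg
  sound αg (resolve {C = C} l dU U≈ dC ¬l∈C) with sound αg dC
  ... | l′ , l′∈C , αl′ with var l′ ≟ᵛ var l
  ...   | no  v≢ = l′ , trans (remove-other C v≢) l′∈C , αl′
  ...   | yes v≡ = ⊥-elim (not-¬ αl αl′-compl)
    where
      -- the unit clause l is true, while l′ sits on var l with sign ¬(sign l)
      αl : α (var l) ≡ sign l
      αl = sat-unit l U≈ (sound αg dU)
      sign-l′ : sign l′ ≡ not (sign l)
      sign-l′ = occOf-injective
        (trans (sym l′∈C)
        (trans (cong C (trans v≡ (sym (var-compl l))))
        (trans ¬l∈C (cong occOf (sign-compl l)))))
      αl′-compl : α (var l) ≡ not (sign l)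
      αl′-compl = trans (cong α (sym v≡)) (trans αl′ sign-l′)

  sound-⊢₁ : ∀ {g h} → SatLit α g → φ ∧ g ⊢₁ h → SatLit α h
  sound-⊢₁ {h = h} αg (C , dC , C≈) = sat-unit h C≈ (sound αg dC)

open Soundness using (sound-⊢₁)

flip : ∀ {n m} → Assignment n m → Var n m → Assignment n m
flip α v u with u ≟ᵛ v
... | yes _ = not (α v)
... | no  _ = α u

flip-at : ∀ {n m} (α : Assignment n m) {u v} → u ≡ v → flip α v u ≡ not (α v)
flip-at α {u} {v} u≡v with u ≟ᵛ v
... | yes _   = refl
... | no  u≢v = ⊥-elim (u≢v u≡v)

flip-other : ∀ {n m} (α : Assignment n m) {u v} → u ≢ v → flip α v u ≡ α u
flip-other α {u} {v} u≢v with u ≟ᵛ v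
... | yes u≡v = ⊥-elim (u≢v u≡v)
... | no  _   = refl

SatAvoiding : ∀ {n m} → Assignment n m → Var n m → Clause n m → Set
SatAvoiding α v C = ∃ λ l → l ∈ᶜ C × SatLit α l × var l ≢ v

flip-preserves : ∀ {n m} (φ : CNF n m) (α : Assignment n m) (v : Var n m) →
  SatCNF α φ →
  (∀ {C} → C ∈ φ → lit v (α v) ∈ᶜ C → SatAvoiding α v C) →
  SatCNF (flip α v) φ
flip-preserves φ α v α⊨φ rescue {C} C∈φ with α⊨φ C∈φ
... | l , l∈C , αl with var l ≟ᵛ v
...   | no  w≢v = l , l∈C , trans (flip-other α w≢v) αl
...   | yes w≡v with rescue C∈φ v-lit∈C
  where
    v-lit∈C : lit v (α v) ∈ᶜ C
    v-lit∈C = trans (cong C (sym w≡v)) (trans l∈C (cong occOf (trans (sym αl) (cong α w≡v))))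
...     | l′ , l′∈C , αl′ , w′≢v = l′ , l′∈C , trans (flip-other α w′≢v) αl′

fresh-index : ∀ {n} → n ≥ 4 → (i j k : Fin n) → i ≢ j → i ≢ k → j ≢ k →
              ∃ λ l → l ≢ i × l ≢ j × l ≢ k
fresh-index (s≤s (s≤s (s≤s (s≤s _)))) i j k i≢j i≢k j≢k =
  l , punchInᵢ≢i i y , l≢j , l≢k
  where
    -- j and k seen in Fin (n - 1) after deleting i, then k after deleting j
    j′ = punchOut i≢j
    k′ = punchOut i≢k
    j′≢k′ : j′ ≢ k′
    j′≢k′ e = j≢k (punchOut-injective i≢j i≢k e)
    k″ = punchOut j′≢k′
    z  = punchIn k″ zero
    y  = punchIn j′ z
    l  = punchIn i y
    l≢j : l ≢ j
    l≢j e = punchInᵢ≢i j′ z (punchIn-injective i y j′ (trans e (sym (punchIn-punchOut i≢j))))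
    l≢k : l ≢ k
    l≢k e = punchInᵢ≢i k″ zero (punchIn-injective j′ z k″
              (trans (punchIn-injective i y k′ (trans e (sym (punchIn-punchOut i≢k))))
                     (sym (punchIn-punchOut j′≢k′))))

negPair-second : ∀ {n m} (a b : Fin n) → b ≢ a → ¬xl b ∈ᶜ negPair {n} {m} a b
negPair-second {m = m} a b b≢a with inj₁ {B = Fin m} b ≟ᵛ inj₁ a
... | yes e = ⊥-elim (b≢a (inj₁-injective e))
... | no  _ with inj₁ {B = Fin m} b ≟ᵛ inj₁ b
...   | yes _   = refl
...   | no  b≢b = ⊥-elim (b≢b refl)

others-false : ∀ {n m} (φ : CNF n m) → IsPEncoding φ → (α : Assignment n m) →
               SatCNF α φ → ∀ l → α (inj₁ l) ≡ true → ∀ t → l ≢ t → α (inj₁ t) ≡ false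
others-false φ (_ , p2) α α⊨φ l αl t l≢t = sound-⊢₁ φ α α⊨φ αl (p2 l t l≢t)

lemma12 : ∀ {n m} (φ : CNF n m) → n ≥ 4 → IsPEncoding φ →
    (i j k : Fin n) → ¬ (i ≡ j) → ¬ (i ≡ k) → ¬ (j ≡ k) →
    ¬ SameClauseSet (InQ φ i) (negPair i j ∷ negPair i k ∷ [])
lemma12 φ n≥4 enc@(p1 , p2) i j k i≢j i≢k j≢k (Q⊆pairs , _)
  with fresh-index n≥4 i j k i≢j i≢k j≢k
... | l , l≢i , l≢j , l≢k with p1 l
... | α , α⊨φ , αl = not-¬ α′i-false α′i-true
  where
    off : ∀ t → l ≢ t → α (inj₁ t) ≡ false
    off = others-false φ enc α α⊨φ l αl
    via-pair : ∀ {C} t → t ≢ i → l ≢ t → C ≈ᶜ negPair i t → SatAvoiding α (inj₁ i) C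
    via-pair {C} t t≢i l≢t C≈ =
      ¬xl t , trans (C≈ (inj₁ t)) (negPair-second i t t≢i) , off t l≢t ,
      λ e → t≢i (inj₁-injective e)
    -- a clause of φ containing ¬x_i lies in Q_{φ,i}, so it is one of the two pairs
    rescue : ∀ {C} → C ∈ φ → lit (inj₁ i) (α (inj₁ i)) ∈ᶜ C → SatAvoiding α (inj₁ i) C
    rescue {C} C∈φ i-lit∈C
      with Q⊆pairs C (C∈φ , trans i-lit∈C (cong occOf (off i l≢i)))
    ... | _ , here refl         , C≈ = via-pair j (λ e → i≢j (sym e)) l≢j C≈
    ... | _ , there (here refl) , C≈ = via-pair k (λ e → i≢k (sym e)) l≢k C≈
    ... | _ , there (there ())  , _
    α′ : Assignment _ _
    α′ = flip α (inj₁ i)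
    α′⊨φ : SatCNF α′ φ
    α′⊨φ = flip-preserves φ α (inj₁ i) α⊨φ rescue
    α′i-true : α′ (inj₁ i) ≡ not false
    α′i-true = trans (flip-at α refl) (cong not (off i l≢i))
    α′i-false : α′ (inj₁ i) ≡ false
    α′i-false = sound-⊢₁ φ α′ α′⊨φ
                  (trans (flip-other α (λ e → l≢i (inj₁-injective e))) αl)
                  (p2 l i l≢i)
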